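{- Let $G$ be a connected finite simple graph on $n\geq 6$ vertices with girth at least $5$. Then $T(G)\leq \frac{n}{3}$.
   Context: The girth of a graph is the length of its shortest cycle (infinite for acyclic graphs). A tree cover of $G$ is a collection of vertex-disjoint simple trees, each an induced subgraph of $G$, covering all vertices of $G$; $T(G)$ is the minimum size of a tree cover. -}

module Defs where

open import Level using (0ℓ)
open import Data.Nat using (ℕ; zero; suc; _≤_; _*_)
open import Data.Fin using (Fin; zero; suc; inject₁; fromℕ)
open import Data.Product using (Σ; ∃; _×_; _,_)
open import Data.Unit using (⊤)
open import Function.Definitions using (Injective)
open import Relation.Nullary using (¬_)
open import Relation.Binary.PropositionalEquality using (_≡_)
open import Relation.Binary.Definitions using (Decidable)

record SimpleGraph (n : ℕ) : Set₁ where
  field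
    Adj    : Fin n → Fin n → Set
    adj?   : Decidable Adj
    sym    : ∀ {u v} → Adj u v → Adj v u
    irrefl : ∀ {u} → ¬ Adj u u

module _ {n : ℕ} (G : SimpleGraph n) where
  open SimpleGraph G

  data WalkIn (P : Fin n → Set) : Fin n → Fin n → Set where
    [_]  : ∀ {u} → P u → WalkIn P u u
    _∷⟨_⟩_ : ∀ {u w v} → P u → Adj u w → WalkIn P w v → WalkIn P u v

  Connected : Set
  Connected = ∀ u v → WalkIn (λ _ → ⊤) u v

  record CycleIn (P : Fin n → Set) (m : ℕ) : Set where
    field
      length≥3 : 3 ≤ suc m
      vert     : Fin (suc m) → Fin n
      distinct : Injective _≡_ _≡_ vert
      inP      : ∀ i → P (vert i)
      step     : ∀ (i : Fin m) → Adj (vert (inject₁ i)) (vert (suc i))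
      close    : Adj (vert (fromℕ m)) (vert zero)

  Cycle : ℕ → Set
  Cycle = CycleIn (λ _ → ⊤)

  -- girth(G) ≥ g : every cycle has length at least g (vacuous if acyclic,
  -- matching girth = ∞).
  GirthAtLeast : ℕ → Set
  GirthAtLeast g = ∀ m → Cycle m → g ≤ suc m

  InducesTree : (Fin n → Set) → Set
  InducesTree P =
    (∃ λ v → P v) ×
    (∀ u v → P u → P v → WalkIn P u v) ×
    (∀ m → ¬ CycleIn P m)

  -- A tree cover with m trees: an assignment of each vertex to one of
  -- m parts (so parts are vertex-disjoint and cover V), each inducing a tree.
  record TreeCover (m : ℕ) : Set where
    field
      part  : Fin n → Fin m
      trees : ∀ (t : Fin m) → InducesTree (λ v → part v ≡ t)

  TreeCoverNumber≤ : ℕ → Set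
  TreeCoverNumber≤ k = ∃ λ m → TreeCover m × m ≤ k

module Submission where

open import Defs
open import Data.Bool.Base using (Bool; true; false)
open import Data.Bool.Properties using (¬-not) renaming (_≟_ to _≟ᵇ_)
open import Data.Empty using (⊥-elim)
open import Data.Fin.Base using (Fin; zero; suc; toℕ; inject₁; fromℕ)
open import Data.Fin.Properties
  using (_≟_; any?; toℕ<n; toℕ≤pred[n]; toℕ-injective; toℕ-inject₁; toℕ-fromℕ; punchInᵢ≢i)
open import Data.List.Base using (allFin)
open import Data.List.Extrema.Nat using (argmin; argmax; f[argmin]≤f[xs]; f[xs]≤f[argmax])
open import Data.List.Membership.Propositional.Properties using (∈-allFin)
import Data.List.Relation.Unary.All as All
open import Data.Nat.Base
  using (ℕ; zero; suc; _+_; _*_; _∸_; _⊓_; _≤_; _<_; z≤n; s≤s; s≤s⁻¹; z<s; NonZero)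
open import Data.Nat.DivMod using (_%_; _/_; m≡m%n+[m/n]*n; [m+kn]%n≡m%n; m<n⇒m%n≡m; m%n<n; %-distribˡ-+)
open import Data.Nat.GeneralisedArithmetic using (iterate)
open import Data.Nat.Properties
  using ( ≤-refl; ≤-reflexive; ≤-trans; <-≤-trans; ≤-<-trans; <⇒≤; <⇒≱; ≰⇒>; _≤?_; 1+n≰n; n≢0⇒n>0
        ; 0≢1+n; m≢1+n+m; ≡-irrelevant; +-comm; +-mono-≤; +-monoˡ-≤; +-monoʳ-≤; +-monoʳ-<; +-cancelˡ-≤
        ; *-zeroʳ; *-identityʳ; *-distribˡ-+; *-monoʳ-≤; m≤m+n; m∸n≤m; ∸-monoˡ-≤; ∸-monoʳ-<; ∸-+-assoc
        ; +-∸-comm; m+[n∸m]≡n; n∸n≡0; m∸n≡0⇒m≤n; ∸-cancelˡ-≡; ∸-distribʳ-⊓; m⊓n≤m; m⊓n≤n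
        ; +-0-commutativeMonoid; module ≤-Reasoning)
open import Data.Nat.Tactic.RingSolver using (solve-∀)
open import Algebra.Properties.CommutativeMonoid.Sum +-0-commutativeMonoid
  using (sum; sum-syntax; sum-cong-≗; sum-remove; ∑-distrib-+; ∑-comm)
open import Data.Product using (∃; ∃₂; _×_; _,_; proj₁; proj₂)
open import Data.Sum using (_⊎_; inj₁; inj₂; [_,_]′)
import Data.Sum as Sum
open import Data.Unit using (tt)
open import Data.Vec.Functional using (removeAt; updateAt)
open import Data.Vec.Functional.Properties using (updateAt-updates; updateAt-minimal)
open import Function using (_∘_; const)
open import Relation.Nullary using (¬_; contradiction; yes; no)
open import Relation.Nullary.Decidable using (_×-dec_)
open import Relation.Binary.PropositionalEquality
  using (_≡_; _≢_; refl; sym; trans; cong; cong₂; subst; module ≡-Reasoning)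

-- A depth-first-search tree T of G is normal: every edge of G joins a vertex to one of its
-- ancestors. For a shift s < 4, cut T into slabs of four consecutive levels, starting at the
-- root and at every depth ≡ −s (mod 4). An edge inside a slab joins a vertex to an ancestor at
-- distance at most 3, and as the girth is at least 5 this ancestor is its parent; so every slab
-- induces a subtree. Each vertex other than the root tops a slab for exactly one shift and the
-- root for all four, so the four covers have n + 3 trees in total. The best one has a trees with
-- 4a ≤ n + 3, which forces 3a ≤ n once n ≥ 6.

𝟙[_≡0] : ℕ → ℕ
𝟙[ zero  ≡0] = 1
𝟙[ suc _ ≡0] = 0

sum-const : ∀ n c → ∑[ i < n ] c ≡ n * c
sum-const zero    c = refl
sum-const (suc n) c = cong (c +_) (sum-const n c)

sum-mono-≤ : ∀ {n} {f g : Fin n → ℕ} → (∀ i → f i ≤ g i) → sum f ≤ sum g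
sum-mono-≤ {zero}  f≤g = z≤n
sum-mono-≤ {suc n} f≤g = +-mono-≤ (f≤g zero) (sum-mono-≤ (f≤g ∘ suc))

sum-scaleˡ : ∀ {n} c (f : Fin n → ℕ) → ∑[ i < n ] (c * f i) ≡ c * sum f
sum-scaleˡ {zero}  c f = sym (*-zeroʳ c)
sum-scaleˡ {suc n} c f = trans (cong (c * f zero +_) (sum-scaleˡ c (f ∘ suc)))
                               (sym (*-distribˡ-+ c (f zero) _))

sum-suc-at : ∀ {n} {f g : Fin (suc n) → ℕ} x →
  f x ≡ suc (g x) → (∀ v → v ≢ x → f v ≡ g v) → sum f ≡ suc (sum g)
sum-suc-at {f = f} {g} x fx≡ f≡g = begin
  sum f                          ≡⟨ sum-remove f ⟩
  f x + sum (removeAt f x)       ≡⟨ cong₂ _+_ fx≡ (sum-cong-≗ (λ j → f≡g _ (punchInᵢ≢i x j))) ⟩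
  suc (g x + sum (removeAt g x)) ≡⟨ cong suc (sum-remove g) ⟨
  suc (sum g)                    ∎
  where open ≡-Reasoning

∃-below-average : ∀ {k} (f : Fin (suc k) → ℕ) → ∃ λ i → suc k * f i ≤ sum f
∃-below-average {k} f = i , (begin
  suc k * f i         ≡⟨ sum-const (suc k) (f i) ⟨
  ∑[ j < suc k ] f i  ≤⟨ sum-mono-≤ (λ j → All.lookup (f[argmin]≤f[xs] {f = f} zero (allFin _)) (∈-allFin j)) ⟩
  sum f               ∎)
  where
  open ≤-Reasoning
  i = argmin f zero (allFin (suc k))

record ZerosEnumeration {n} (g : Fin n → ℕ) (c : ℕ) : Set where
  field
    index         : ∀ v → g v ≡ 0 → Fin c
    element       : Fin c → Fin n
    element-zero  : ∀ i → g (element i) ≡ 0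
    element-index : ∀ v p → element (index v p) ≡ v
    index-element : ∀ i p → index (element i) p ≡ i

  index-cong : ∀ {u v} p q → u ≡ v → index u p ≡ index v q
  index-cong p q refl = cong (index _) (≡-irrelevant p q)

enumerateZeros : ∀ {n} (g : Fin n → ℕ) → ZerosEnumeration g (∑[ v < n ] 𝟙[ g v ≡0])
enumerateZeros {zero}  g = record
  { index = λ () ; element = λ () ; element-zero = λ () ; element-index = λ () ; index-element = λ () }
enumerateZeros {suc n} g with g zero in g0 | enumerateZeros (g ∘ suc)
... | zero  | E = record
  { index         = λ { zero _ → zero ; (suc v) p → suc (index v p) }
  ; element       = λ { zero → zero ; (suc i) → suc (element i) }
  ; element-zero  = λ { zero → g0 ; (suc i) → element-zero i }
  ; element-index = λ { zero _ → refl ; (suc v) p → cong suc (element-index v p) }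
  ; index-element = λ { zero _ → refl ; (suc i) p → cong suc (index-element i p) }
  }
  where open ZerosEnumeration E
... | suc _ | E = record
  { index         = λ { zero p → contradiction (trans (sym p) g0) 0≢1+n ; (suc v) p → index v p }
  ; element       = suc ∘ element
  ; element-zero  = element-zero
  ; element-index = λ { zero p → contradiction (trans (sym p) g0) 0≢1+n ; (suc v) p → cong suc (element-index v p) }
  ; index-element = index-element
  }
  where open ZerosEnumeration E

unique-zero⇒≤1 : ∀ {n c} {g : Fin n → ℕ} → ZerosEnumeration g c →
  (∀ u v → g u ≡ 0 → g v ≡ 0 → u ≡ v) → c ≤ 1
unique-zero⇒≤1 {c = zero}        E unique = z≤n
unique-zero⇒≤1 {c = suc zero}    E unique = s≤s z≤n
unique-zero⇒≤1 {c = suc (suc c)} E unique = contradiction 0≡1 λ ()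
  where
  open ZerosEnumeration E
  0≡1 : zero ≡ suc zero
  0≡1 = begin
    zero                                                  ≡⟨ index-element zero (element-zero zero) ⟨
    index (element zero) (element-zero zero)
      ≡⟨ index-cong _ _ (unique _ _ (element-zero zero) (element-zero (suc zero))) ⟩
    index (element (suc zero)) (element-zero (suc zero))  ≡⟨ index-element (suc zero) _ ⟩
    suc zero                                              ∎
    where open ≡-Reasoning

iterate-+ : ∀ {A : Set} (f : A → A) x i j → iterate f x (i + j) ≡ iterate f (iterate f x i) j
iterate-+ f x zero    j = refl
iterate-+ f x (suc i) j = iterate-+ f (f x) i j

iterate-suc : ∀ {A : Set} (f : A → A) x j → iterate f x (suc j) ≡ f (iterate f x j)
iterate-suc f x zero    = refl
iterate-suc f x (suc j) = iterate-suc f (f x) j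

iterate-fixed : ∀ {A : Set} {f : A → A} {x} → f x ≡ x → ∀ j → iterate f x j ≡ x
iterate-fixed         fx≡x zero    = refl
iterate-fixed {f = f} fx≡x (suc j) = trans (cong (λ y → iterate f y j) fx≡x) (iterate-fixed fx≡x j)

Ancestor : ∀ {A : Set} → (A → A) → A → A → Set
Ancestor parent u v = ∃ λ j → iterate parent v j ≡ u

ChildOf : ∀ {A : Set} → (A → A) → (A → ℕ) → A → A → Set
ChildOf parent depth u v = parent v ≡ u × depth v ≡ suc (depth u)

fromℕ⊎inject₁ : ∀ {k} (i : Fin (suc k)) → i ≡ fromℕ k ⊎ ∃ λ j → i ≡ inject₁ j
fromℕ⊎inject₁ {zero}  zero    = inj₁ refl
fromℕ⊎inject₁ {suc k} zero    = inj₂ (zero , refl)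
fromℕ⊎inject₁ {suc k} (suc i) with fromℕ⊎inject₁ i
... | inj₁ refl       = inj₁ refl
... | inj₂ (j , refl) = inj₂ (suc j , refl)

module _ {n} {G : SimpleGraph n} where
  open SimpleGraph G renaming (sym to adj-sym)

  walk-head : ∀ {P u v} → WalkIn G P u v → P u
  walk-head [ pu ]        = pu
  walk-head (pu ∷⟨ _ ⟩ _) = pu

  infixr 5 _++ʷ_
  _++ʷ_ : ∀ {P u v w} → WalkIn G P u v → WalkIn G P v w → WalkIn G P u w
  [ _ ]         ++ʷ q = q
  (pu ∷⟨ e ⟩ p) ++ʷ q = pu ∷⟨ e ⟩ (p ++ʷ q)

  reverseʷ : ∀ {P u v} → WalkIn G P u v → WalkIn G P v u
  reverseʷ [ pu ]        = [ pu ]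
  reverseʷ (pu ∷⟨ e ⟩ p) = reverseʷ p ++ʷ (walk-head p ∷⟨ adj-sym e ⟩ [ pu ])

  cycle-neighbours : ∀ {P k} (C : CycleIn G P (suc (suc k))) → let open CycleIn C in
    ∀ p → ∃₂ λ a c → a ≢ c × Adj (vert p) (vert a) × Adj (vert p) (vert c)
  cycle-neighbours {k = k} C zero = suc zero , fromℕ (suc (suc k)) , (λ ()) , step zero , adj-sym close
    where open CycleIn C
  cycle-neighbours {k = k} C (suc i) with fromℕ⊎inject₁ i
  ... | inj₁ refl       = inject₁ (fromℕ (suc k)) , zero , (λ ()) , adj-sym (step (fromℕ (suc k))) , close
    where open CycleIn C
  ... | inj₂ (j , refl) =
    inject₁ (inject₁ j) , suc (suc j) , distinct-positions , adj-sym (step (inject₁ j)) , step (suc j)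
    where
    open CycleIn C
    distinct-positions : inject₁ (inject₁ j) ≢ suc (suc j)
    distinct-positions e = m≢1+n+m (toℕ j)
      (trans (sym (trans (toℕ-inject₁ (inject₁ j)) (toℕ-inject₁ j))) (cong toℕ e))

  -- A cycle has two distinct neighbours of its deepest vertex; with only tree edges both would be its parent.
  tree-edges⇒acyclic : ∀ {P} (parent : Fin n → Fin n) (depth : Fin n → ℕ) →
    (∀ u v → P u → P v → Adj u v → ChildOf parent depth u v ⊎ ChildOf parent depth v u) →
    ∀ m → ¬ CycleIn G P m
  tree-edges⇒acyclic _ _ _ zero       C with CycleIn.length≥3 C
  ... | s≤s ()
  tree-edges⇒acyclic _ _ _ (suc zero) C with CycleIn.length≥3 C
  ... | s≤s (s≤s ())
  tree-edges⇒acyclic parent depth tree-edge (suc (suc k)) C = two-parents (cycle-neighbours C deepest)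
    where
    open CycleIn C
    deepest : Fin (suc (suc (suc k)))
    deepest = argmax (λ q → depth (vert q)) zero (allFin _)
    maximal : ∀ q → depth (vert q) ≤ depth (vert deepest)
    maximal q = All.lookup (f[xs]≤f[argmax] {f = λ q → depth (vert q)} zero (allFin _)) (∈-allFin q)
    parent≡ : ∀ q → Adj (vert deepest) (vert q) → parent (vert deepest) ≡ vert q
    parent≡ q e = [ ⊥-elim ∘ not-deeper , proj₁ ]′ (tree-edge (vert deepest) (vert q) (inP deepest) (inP q) e)
      where
      not-deeper : ¬ ChildOf parent depth (vert deepest) (vert q)
      not-deeper (_ , depth≡) = 1+n≰n (≤-trans (≤-reflexive (sym depth≡)) (maximal q))
    two-parents : ¬ ∃₂ λ a c → a ≢ c × Adj (vert deepest) (vert a) × Adj (vert deepest) (vert c)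
    two-parents (a , c , a≢c , adj-a , adj-c) = a≢c (distinct (trans (sym (parent≡ a adj-a)) (parent≡ c adj-c)))

-- Normal spanning trees

module _ {n} (G : SimpleGraph n) where
  open SimpleGraph G renaming (sym to adj-sym)

  record NormalTree : Set where
    field
      root         : Fin n
      parent       : Fin n → Fin n
      depth        : Fin n → ℕ
      depth-root   : depth root ≡ 0
      depth-parent : ∀ v → depth (parent v) ≡ depth v ∸ 1
      depth≡0⇒root : ∀ v → depth v ≡ 0 → v ≡ root
      adj-parent   : ∀ v → depth v ≢ 0 → Adj v (parent v)
      normal       : ∀ u v → Adj u v → Ancestor parent u v ⊎ Ancestor parent v u

    parent-root : parent root ≡ root
    parent-root = depth≡0⇒root _ (trans (depth-parent root) (cong (_∸ 1) depth-root))

    child-parent : ∀ v → depth v ≢ 0 → ChildOf parent depth (parent v) v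
    child-parent v d≢0 = refl , sym (trans (cong suc (depth-parent v)) (m+[n∸m]≡n (n≢0⇒n>0 d≢0)))

    depth-iterate : ∀ v j → depth (iterate parent v j) ≡ depth v ∸ j
    depth-iterate v zero    = refl
    depth-iterate v (suc j) = begin
      depth (iterate parent (parent v) j)  ≡⟨ depth-iterate (parent v) j ⟩
      depth (parent v) ∸ j                 ≡⟨ cong (_∸ j) (depth-parent v) ⟩
      depth v ∸ 1 ∸ j                      ≡⟨ ∸-+-assoc (depth v) 1 j ⟩
      depth v ∸ suc j                      ∎
      where open ≡-Reasoning

    iterate-injective : ∀ v {i j} → i ≤ depth v → j ≤ depth v →
      iterate parent v i ≡ iterate parent v j → i ≡ j
    iterate-injective v {i} {j} i≤d j≤d e = ∸-cancelˡ-≡ i≤d j≤d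
      (trans (sym (depth-iterate v i)) (trans (cong depth e) (depth-iterate v j)))

    ancestor-within-depth : ∀ {u v} → Ancestor parent u v → ∃ λ j → j ≤ depth v × iterate parent v j ≡ u
    ancestor-within-depth {u} {v} (j , v↑j≡u) with j ≤? depth v
    ... | yes j≤d = j , j≤d , v↑j≡u
    ... | no  j≰d = d , ≤-refl , (begin
      iterate parent v d                           ≡⟨ v↑d≡root ⟩
      root                                         ≡⟨ iterate-fixed parent-root (j ∸ d) ⟨
      iterate parent root (j ∸ d)                  ≡⟨ cong (λ x → iterate parent x (j ∸ d)) v↑d≡root ⟨
      iterate parent (iterate parent v d) (j ∸ d)  ≡⟨ iterate-+ parent v d (j ∸ d) ⟨
      iterate parent v (d + (j ∸ d))               ≡⟨ cong (iterate parent v) (m+[n∸m]≡n (<⇒≤ (≰⇒> j≰d))) ⟩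
      iterate parent v j                           ≡⟨ v↑j≡u ⟩
      u                                            ∎)
      where
      open ≡-Reasoning
      d = depth v
      v↑d≡root : iterate parent v d ≡ root
      v↑d≡root = depth≡0⇒root _ (trans (depth-iterate v d) (n∸n≡0 d))

    adj-iterate : ∀ v {j} → j < depth v → Adj (iterate parent v j) (iterate parent v (suc j))
    adj-iterate v {j} j<d = subst (Adj _) (sym (iterate-suc parent v j))
      (adj-parent _ λ d≡0 → <⇒≱ j<d (m∸n≡0⇒m≤n (trans (sym (depth-iterate v j)) d≡0)))

    ¬adj-ancestor : ∀ {g} → GirthAtLeast G g → ∀ v {j} → 2 ≤ j → suc j < g → j ≤ depth v →
      ¬ Adj (iterate parent v j) v
    ¬adj-ancestor girth v {j} 2≤j j<g j≤d adj = <⇒≱ j<g (girth j (record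
      { length≥3 = s≤s 2≤j
      ; vert     = vert
      ; distinct = λ {i} {i′} e → toℕ-injective
          (iterate-injective v (≤-trans (toℕ≤pred[n] i) j≤d) (≤-trans (toℕ≤pred[n] i′) j≤d) e)
      ; inP      = λ _ → tt
      ; step     = λ i → subst (λ k → Adj (iterate parent v k) (vert (suc i))) (sym (toℕ-inject₁ i))
                             (adj-iterate v (<-≤-trans (toℕ<n i) j≤d))
      ; close    = subst (λ k → Adj (iterate parent v k) v) (sym (toℕ-fromℕ j)) adj
      }))
      where
      vert : Fin (suc j) → Fin n
      vert i = iterate parent v (toℕ i)

-- Depth-first search
𝟙[_≡false] : Bool → ℕ
𝟙[ false ≡false] = 1
𝟙[ true  ≡false] = 0

module DepthFirstSearch {n} (G : SimpleGraph (suc n)) (root : Fin (suc n)) where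
  open SimpleGraph G renaming (sym to adj-sym)

  V : Set
  V = Fin (suc n)

  record SearchState : Set where
    field
      visited : V → Bool
      parent  : V → V
      depth   : V → ℕ
      current : V

    Seen : V → Set
    Seen v = visited v ≡ true

    Closed : V → Set
    Closed u = ∀ w → Adj u w → Seen w

    unseen : ℕ
    unseen = ∑[ v < suc n ] 𝟙[ visited v ≡false]

    potential : ℕ
    potential = 2 * unseen + depth current

  record Invariant (S : SearchState) : Set where
    open SearchState S
    field
      root-seen         : Seen root
      current-seen      : Seen current
      depth-root        : depth root ≡ 0
      parent-seen       : ∀ v → Seen v → Seen (parent v)
      depth-parent      : ∀ v → Seen v → depth (parent v) ≡ depth v ∸ 1
      depth≡0⇒root      : ∀ v → Seen v → depth v ≡ 0 → v ≡ root
      adj-parent        : ∀ v → Seen v → depth v ≢ 0 → Adj v (parent v)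
      normal            : ∀ u v → Seen u → Seen v → Adj u v → Ancestor parent u v ⊎ Ancestor parent v u
      on-path-or-closed : ∀ u → Seen u → Ancestor parent u current ⊎ Closed u

    parent-root : parent root ≡ root
    parent-root = depth≡0⇒root _ (parent-seen root root-seen)
      (trans (depth-parent root root-seen) (cong (_∸ 1) depth-root))

  initial : SearchState
  initial = record
    { visited = updateAt (const false) root (const true)
    ; parent  = const root
    ; depth   = const 0
    ; current = root
    }

  initial-invariant : Invariant initial
  initial-invariant = record
    { root-seen         = updateAt-updates root (const false)
    ; current-seen      = updateAt-updates root (const false)
    ; depth-root        = refl
    ; parent-seen       = λ _ _ → updateAt-updates root (const false)
    ; depth-parent      = λ _ _ → refl
    ; depth≡0⇒root      = λ v v-seen _ → only-root v v-seen
    ; adj-parent        = λ _ _ 0≢0 → contradiction refl 0≢0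
    ; normal            = λ u v u-seen v-seen adj → contradiction
        (subst (Adj u) (trans (only-root v v-seen) (sym (only-root u u-seen))) adj) irrefl
    ; on-path-or-closed = λ u u-seen → inj₁ (0 , sym (only-root u u-seen))
    }
    where
    only-root : ∀ v → updateAt (const false) root (const true) v ≡ true → v ≡ root
    only-root v v-seen with v ≟ root
    ... | yes v≡root = v≡root
    ... | no  v≢root = contradiction (trans (sym (updateAt-minimal v root (const false) v≢root)) v-seen) λ ()

  module Extend (S : SearchState) (I : Invariant S) (x : V) (adj : Adj (SearchState.current S) x)
                (x-unseen : SearchState.visited S x ≡ false) where
    open SearchState S
    open Invariant I

    next : SearchState
    next = record
      { visited = updateAt visited x (const true)
      ; parent  = updateAt parent x (const current)
      ; depth   = updateAt depth x (const (suc (depth current)))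
      ; current = x
      }

    open SearchState next using ()
      renaming (visited to visited′; parent to parent′; depth to depth′; Seen to Seen′; unseen to unseen′)

    parent′x≡current : parent′ x ≡ current
    parent′x≡current = updateAt-updates x parent

    depth′x≡ : depth′ x ≡ suc (depth current)
    depth′x≡ = updateAt-updates x depth

    ¬seen-x : ¬ Seen x
    ¬seen-x x-seen = contradiction (trans (sym x-seen) x-unseen) λ ()

    seen⇒≢x : ∀ {v} → Seen v → v ≢ x
    seen⇒≢x v-seen refl = ¬seen-x v-seen

    x-or-seen : ∀ v → Seen′ v → v ≡ x ⊎ Seen v
    x-or-seen v v-seen′ with v ≟ x
    ... | yes v≡x = inj₁ v≡x
    ... | no  v≢x = inj₂ (trans (sym (updateAt-minimal v x visited v≢x)) v-seen′)

    seen⇒seen′ : ∀ {v} → Seen v → Seen′ v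
    seen⇒seen′ v-seen = trans (updateAt-minimal _ x visited (seen⇒≢x v-seen)) v-seen

    parent′≡ : ∀ {v} → Seen v → parent′ v ≡ parent v
    parent′≡ v-seen = updateAt-minimal _ x parent (seen⇒≢x v-seen)

    depth′≡ : ∀ {v} → Seen v → depth′ v ≡ depth v
    depth′≡ v-seen = updateAt-minimal _ x depth (seen⇒≢x v-seen)

    iterate-parent′ : ∀ {v} → Seen v → ∀ j → iterate parent′ v j ≡ iterate parent v j
    iterate-parent′ v-seen zero    = refl
    iterate-parent′ v-seen (suc j) = trans (cong (λ w → iterate parent′ w j) (parent′≡ v-seen))
                                           (iterate-parent′ (parent-seen _ v-seen) j)

    ancestor′ : ∀ {u v} → Seen v → Ancestor parent u v → Ancestor parent′ u v
    ancestor′ v-seen (j , v↑j≡u) = j , trans (iterate-parent′ v-seen j) v↑j≡u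

    on-path′-or-closed : ∀ {u} → Seen u → Ancestor parent′ u x ⊎ Closed u
    on-path′-or-closed u-seen with on-path-or-closed _ u-seen
    ... | inj₁ (j , c↑j≡u) = inj₁ (suc j , trans (cong (λ w → iterate parent′ w j) parent′x≡current)
                                                 (trans (iterate-parent′ current-seen j) c↑j≡u))
    ... | inj₂ u-closed    = inj₂ u-closed

    invariant : Invariant next
    invariant = record
      { root-seen         = seen⇒seen′ root-seen
      ; current-seen      = updateAt-updates x visited
      ; depth-root        = trans (depth′≡ root-seen) depth-root
      ; parent-seen       = parent-seen′
      ; depth-parent      = depth-parent′
      ; depth≡0⇒root      = depth≡0⇒root′
      ; adj-parent        = adj-parent′
      ; normal            = normal′
      ; on-path-or-closed = on-path-or-closed′
      }
      where
      parent-seen′ : ∀ v → Seen′ v → Seen′ (parent′ v)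
      parent-seen′ v v-seen′ with x-or-seen v v-seen′
      ... | inj₁ refl   = trans (cong visited′ parent′x≡current) (seen⇒seen′ current-seen)
      ... | inj₂ v-seen = trans (cong visited′ (parent′≡ v-seen)) (seen⇒seen′ (parent-seen v v-seen))

      depth-parent′ : ∀ v → Seen′ v → depth′ (parent′ v) ≡ depth′ v ∸ 1
      depth-parent′ v v-seen′ with x-or-seen v v-seen′
      ... | inj₁ refl   = trans (cong depth′ parent′x≡current)
                                (trans (depth′≡ current-seen) (cong (_∸ 1) (sym depth′x≡)))
      ... | inj₂ v-seen = trans (cong depth′ (parent′≡ v-seen)) (trans (depth′≡ (parent-seen v v-seen))
                                (trans (depth-parent v v-seen) (cong (_∸ 1) (sym (depth′≡ v-seen)))))

      depth≡0⇒root′ : ∀ v → Seen′ v → depth′ v ≡ 0 → v ≡ root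
      depth≡0⇒root′ v v-seen′ d≡0 with x-or-seen v v-seen′
      ... | inj₁ refl   = contradiction (trans (sym depth′x≡) d≡0) λ ()
      ... | inj₂ v-seen = depth≡0⇒root v v-seen (trans (sym (depth′≡ v-seen)) d≡0)

      adj-parent′ : ∀ v → Seen′ v → depth′ v ≢ 0 → Adj v (parent′ v)
      adj-parent′ v v-seen′ d≢0 with x-or-seen v v-seen′
      ... | inj₁ refl   = subst (Adj x) (sym parent′x≡current) (adj-sym adj)
      ... | inj₂ v-seen = subst (Adj v) (sym (parent′≡ v-seen))
                                (adj-parent v v-seen λ d≡0 → d≢0 (trans (depth′≡ v-seen) d≡0))

      -- A seen neighbour of the unseen x cannot be closed, so it lies on the path to x.
      normal′ : ∀ u v → Seen′ u → Seen′ v → Adj u v → Ancestor parent′ u v ⊎ Ancestor parent′ v u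
      normal′ u v u-seen′ v-seen′ adj′ with x-or-seen u u-seen′ | x-or-seen v v-seen′
      ... | inj₁ refl   | inj₁ refl   = contradiction adj′ irrefl
      ... | inj₁ refl   | inj₂ v-seen =
        [ inj₂ , (λ v-closed → ⊥-elim (¬seen-x (v-closed x (adj-sym adj′)))) ]′ (on-path′-or-closed v-seen)
      ... | inj₂ u-seen | inj₁ refl   =
        [ inj₁ , (λ u-closed → ⊥-elim (¬seen-x (u-closed x adj′))) ]′ (on-path′-or-closed u-seen)
      ... | inj₂ u-seen | inj₂ v-seen = Sum.map (ancestor′ v-seen) (ancestor′ u-seen) (normal u v u-seen v-seen adj′)

      on-path-or-closed′ : ∀ u → Seen′ u → Ancestor parent′ u x ⊎ SearchState.Closed next u
      on-path-or-closed′ u u-seen′ with x-or-seen u u-seen′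
      ... | inj₁ refl   = inj₁ (0 , refl)
      ... | inj₂ u-seen = Sum.map₂ (λ u-closed w adj → seen⇒seen′ (u-closed w adj)) (on-path′-or-closed u-seen)

    potential-decreases : SearchState.potential next < potential
    potential-decreases = ≤-reflexive (begin
      suc (2 * unseen′ + depth′ x)             ≡⟨ cong (λ d → suc (2 * unseen′ + d)) depth′x≡ ⟩
      suc (2 * unseen′ + suc (depth current))  ≡⟨ rebalance unseen′ (depth current) ⟩
      2 * suc unseen′ + depth current          ≡⟨ cong (λ u → 2 * u + depth current) unseen≡ ⟨
      potential                                ∎)
      where
      open ≡-Reasoning
      unseen≡ : unseen ≡ suc unseen′
      unseen≡ = sum-suc-at x
        (trans (cong 𝟙[_≡false] x-unseen) (cong (suc ∘ 𝟙[_≡false]) (sym (updateAt-updates x visited))))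
        (λ v v≢x → cong 𝟙[_≡false] (sym (updateAt-minimal v x visited v≢x)))
      rebalance : ∀ u d → suc (2 * u + suc d) ≡ 2 * suc u + d
      rebalance = solve-∀

  module Retreat (S : SearchState) (I : Invariant S) (current≢root : SearchState.current S ≢ root)
                 (current-closed : SearchState.Closed S (SearchState.current S)) where
    open SearchState S
    open Invariant I

    next : SearchState
    next = record S { current = parent current }

    invariant : Invariant next
    invariant = record
      { root-seen         = root-seen
      ; current-seen      = parent-seen current current-seen
      ; depth-root        = depth-root
      ; parent-seen       = parent-seen
      ; depth-parent      = depth-parent
      ; depth≡0⇒root      = depth≡0⇒root
      ; adj-parent        = adj-parent
      ; normal            = normal
      ; on-path-or-closed = on-path-or-closed′
      }
      where
      on-path-or-closed′ : ∀ u → Seen u → Ancestor parent u (parent current) ⊎ Closed u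
      on-path-or-closed′ u u-seen with on-path-or-closed u u-seen
      ... | inj₁ (zero  , refl)  = inj₂ current-closed
      ... | inj₁ (suc j , c↑j≡u) = inj₁ (j , c↑j≡u)
      ... | inj₂ u-closed        = inj₂ u-closed

    potential-decreases : SearchState.potential next < potential
    potential-decreases = +-monoʳ-< (2 * unseen) (subst (_< depth current)
      (sym (depth-parent current current-seen)) (∸-monoʳ-< z<s (n≢0⇒n>0 d≢0)))
      where
      d≢0 : depth current ≢ 0
      d≢0 = current≢root ∘ depth≡0⇒root current current-seen

  module Finish (S : SearchState) (I : Invariant S) (current≡root : SearchState.current S ≡ root)
                (current-closed : SearchState.Closed S (SearchState.current S)) where
    open SearchState S
    open Invariant I

    seen⇒closed : ∀ u → Seen u → Closed u
    seen⇒closed u u-seen with on-path-or-closed u u-seen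
    ... | inj₂ u-closed    = u-closed
    ... | inj₁ (j , c↑j≡u) = subst Closed (begin
      current                   ≡⟨ iterate-fixed (subst (λ c → parent c ≡ c) (sym current≡root) parent-root) j ⟨
      iterate parent current j  ≡⟨ c↑j≡u ⟩
      u                         ∎) current-closed
      where open ≡-Reasoning

    walk-seen : ∀ {P u v} → WalkIn G P u v → Seen u → Seen v
    walk-seen [ _ ]             u-seen = u-seen
    walk-seen (_ ∷⟨ adj ⟩ walk) u-seen = walk-seen walk (seen⇒closed _ u-seen _ adj)

    normalTree : Connected G → NormalTree G
    normalTree connected = record
      { root         = root
      ; parent       = parent
      ; depth        = depth
      ; depth-root   = depth-root
      ; depth-parent = λ v → depth-parent v (all-seen v)
      ; depth≡0⇒root = λ v → depth≡0⇒root v (all-seen v)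
      ; adj-parent   = λ v → adj-parent v (all-seen v)
      ; normal       = λ u v → normal u v (all-seen u) (all-seen v)
      }
      where
      all-seen : ∀ v → Seen v
      all-seen v = walk-seen (connected root v) root-seen

  Progress : SearchState → Set
  Progress S = ∃ λ S′ → Invariant S′ × SearchState.potential S′ < SearchState.potential S

  no-unseen-neighbour⇒closed : ∀ S →
    ¬ (∃ λ x → Adj (SearchState.current S) x × SearchState.visited S x ≡ false) →
    SearchState.Closed S (SearchState.current S)
  no-unseen-neighbour⇒closed S none w adj = ¬-not λ w-unseen → none (w , adj , w-unseen)

  step : Connected G → ∀ S → Invariant S → NormalTree G ⊎ Progress S
  step connected S I with any? (λ x → adj? (SearchState.current S) x ×-dec (SearchState.visited S x ≟ᵇ false))
  ... | yes (x , adj , x-unseen) = inj₂ (next , invariant , potential-decreases)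
    where open Extend S I x adj x-unseen
  ... | no none with SearchState.current S ≟ root
  ...   | yes current≡root = inj₁ (normalTree connected)
    where open Finish S I current≡root (no-unseen-neighbour⇒closed S none)
  ...   | no  current≢root = inj₂ (next , invariant , potential-decreases)
    where open Retreat S I current≢root (no-unseen-neighbour⇒closed S none)

  search : Connected G → ∀ fuel S → Invariant S → SearchState.potential S < fuel → NormalTree G
  search connected (suc fuel) S I p<fuel with step connected S I
  ... | inj₁ T                = T
  ... | inj₂ (S′ , I′ , p′<p) = search connected fuel S′ I′ (≤-trans p′<p (s≤s⁻¹ p<fuel))

normalTree : ∀ {n} (G : SimpleGraph (suc n)) → Connected G → NormalTree G
normalTree G connected = search connected (suc (SearchState.potential initial)) initial initial-invariant ≤-refl
  where open DepthFirstSearch G zero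

-- Slabs

[m∸o]%n≡m%n∸o : ∀ m n {o} .{{_ : NonZero n}} → o ≤ m % n → (m ∸ o) % n ≡ m % n ∸ o
[m∸o]%n≡m%n∸o m n {o} o≤m%n = begin
  (m ∸ o) % n                   ≡⟨ cong (λ k → (k ∸ o) % n) (m≡m%n+[m/n]*n m n) ⟩
  (m % n + m / n * n ∸ o) % n   ≡⟨ cong (_% n) (+-∸-comm (m / n * n) o≤m%n) ⟩
  (m % n ∸ o + m / n * n) % n   ≡⟨ [m+kn]%n≡m%n (m % n ∸ o) (m / n) n ⟩
  (m % n ∸ o) % n               ≡⟨ m<n⇒m%n≡m (≤-<-trans (m∸n≤m (m % n) o) (m%n<n m n)) ⟩
  m % n ∸ o                     ∎
  where open ≡-Reasoning

-- With shift s the slabs are cut at the root and at the depths d with d + s ≡ 0 (mod 4);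
-- a vertex of depth d lies slabOffset s d levels below the top of its slab.
slabOffset : ℕ → ℕ → ℕ
slabOffset s d = d ⊓ ((d + s) % 4)

slabOffset≤depth : ∀ s d → slabOffset s d ≤ d
slabOffset≤depth s d = m⊓n≤m d _

slabOffset≤3 : ∀ s d → slabOffset s d ≤ 3
slabOffset≤3 s d = ≤-trans (m⊓n≤n d _) (s≤s⁻¹ (m%n<n (d + s) 4))

slabOffset-∸ : ∀ s d {j} → j ≤ slabOffset s d → slabOffset s (d ∸ j) ≡ slabOffset s d ∸ j
slabOffset-∸ s d {j} j≤o = begin
  (d ∸ j) ⊓ ((d ∸ j + s) % 4)   ≡⟨ cong (λ k → (d ∸ j) ⊓ (k % 4)) (+-∸-comm s j≤d) ⟨
  (d ∸ j) ⊓ ((d + s ∸ j) % 4)   ≡⟨ cong ((d ∸ j) ⊓_) ([m∸o]%n≡m%n∸o (d + s) 4 (≤-trans j≤o (m⊓n≤n d _))) ⟩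
  (d ∸ j) ⊓ ((d + s) % 4 ∸ j)   ≡⟨ ∸-distribʳ-⊓ j d _ ⟨
  slabOffset s d ∸ j            ∎
  where
  open ≡-Reasoning
  j≤d = ≤-trans j≤o (slabOffset≤depth s d)

∑-rotations : ∀ c → c < 4 → ∑[ s < 4 ] 𝟙[ (c + toℕ s) % 4 ≡0] ≡ 1
∑-rotations 0 _ = refl
∑-rotations 1 _ = refl
∑-rotations 2 _ = refl
∑-rotations 3 _ = refl
∑-rotations (suc (suc (suc (suc _)))) (s≤s (s≤s (s≤s (s≤s ()))))

𝟙[suc⊓≡0] : ∀ d k → 𝟙[ suc d ⊓ k ≡0] ≡ 𝟙[ k ≡0]
𝟙[suc⊓≡0] d zero    = refl
𝟙[suc⊓≡0] d (suc k) = refl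

∑-slabOffset≡0 : ∀ d → ∑[ s < 4 ] 𝟙[ slabOffset (toℕ s) d ≡0] ≡ 1 + 3 * 𝟙[ d ≡0]
∑-slabOffset≡0 zero    = refl
∑-slabOffset≡0 (suc d) = begin
  ∑[ s < 4 ] 𝟙[ slabOffset (toℕ s) (suc d) ≡0]   ≡⟨ sum-cong-≗ {4} (λ s → 𝟙[suc⊓≡0] d ((suc d + toℕ s) % 4)) ⟩
  ∑[ s < 4 ] 𝟙[ (suc d + toℕ s) % 4 ≡0]          ≡⟨ sum-cong-≗ {4} (λ s → cong 𝟙[_≡0] (rotate s)) ⟩
  ∑[ s < 4 ] 𝟙[ (suc d % 4 + toℕ s) % 4 ≡0]      ≡⟨ ∑-rotations (suc d % 4) (m%n<n (suc d) 4) ⟩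
  1                                               ∎
  where
  open ≡-Reasoning
  rotate : ∀ (s : Fin 4) → (suc d + toℕ s) % 4 ≡ (suc d % 4 + toℕ s) % 4
  rotate s = trans (%-distribˡ-+ (suc d) (toℕ s) 4)
                   (cong (λ k → (suc d % 4 + k) % 4) (m<n⇒m%n≡m (toℕ<n s)))

module Slabs {n} {G : SimpleGraph n} (T : NormalTree G) (s : ℕ) where
  open SimpleGraph G renaming (sym to adj-sym)
  open NormalTree T

  offset : Fin n → ℕ
  offset v = slabOffset s (depth v)

  top : Fin n → Fin n
  top v = iterate parent v (offset v)

  offset-iterate : ∀ v {j} → j ≤ offset v → offset (iterate parent v j) ≡ offset v ∸ j
  offset-iterate v {j} j≤o = trans (cong (slabOffset s) (depth-iterate v j)) (slabOffset-∸ s (depth v) j≤o)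

  top-iterate : ∀ v {j} → j ≤ offset v → top (iterate parent v j) ≡ top v
  top-iterate v {j} j≤o = begin
    iterate parent (iterate parent v j) (offset (iterate parent v j)) ≡⟨ cong (iterate parent _) (offset-iterate v j≤o) ⟩
    iterate parent (iterate parent v j) (offset v ∸ j)                ≡⟨ iterate-+ parent v j (offset v ∸ j) ⟨
    iterate parent v (j + (offset v ∸ j))                             ≡⟨ cong (iterate parent v) (m+[n∸m]≡n j≤o) ⟩
    top v                                                             ∎
    where open ≡-Reasoning

  offset-top : ∀ v → offset (top v) ≡ 0
  offset-top v = trans (offset-iterate v ≤-refl) (n∸n≡0 (offset v))

  same-top⇒distance≤3 : ∀ v {j} → j ≤ depth v → top (iterate parent v j) ≡ top v → j ≤ 3
  same-top⇒distance≤3 v {j} j≤d same-top =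
    ≤-trans (m≤m+n j (offset u)) (≤-trans (≤-reflexive j+o≡o) (slabOffset≤3 s (depth v)))
    where
    u = iterate parent v j
    j+o≤d : j + offset u ≤ depth v
    j+o≤d = ≤-trans (+-monoʳ-≤ j (≤-trans (slabOffset≤depth s (depth u)) (≤-reflexive (depth-iterate v j))))
                    (≤-reflexive (m+[n∸m]≡n j≤d))
    j+o≡o : j + offset u ≡ offset v
    j+o≡o = iterate-injective v j+o≤d (slabOffset≤depth s (depth v))
              (trans (iterate-+ parent v j (offset u)) same-top)

  -- Sharing a top puts the ancestor at most 3 levels up; girth ≥ 5 excludes distances 2 and 3.
  slab-edge⇒child : GirthAtLeast G 5 → ∀ {u v} → Adj u v → top u ≡ top v → Ancestor parent u v →
    ChildOf parent depth u v
  slab-edge⇒child girth {u} {v} adj same-top u≤v with ancestor-within-depth u≤v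
  ... | j , j≤d , refl = by-distance j j≤d (same-top⇒distance≤3 v j≤d same-top) adj
    where
    by-distance : ∀ j → j ≤ depth v → j ≤ 3 → Adj (iterate parent v j) v →
      ChildOf parent depth (iterate parent v j) v
    by-distance zero          _   _   adj = contradiction adj irrefl
    by-distance (suc zero)    1≤d _   adj = child-parent v λ d≡0 → contradiction (subst (1 ≤_) d≡0 1≤d) λ ()
    by-distance (suc (suc j)) j≤d j≤3 adj =
      contradiction adj (¬adj-ancestor girth v (s≤s (s≤s z≤n)) (s≤s (s≤s j≤3)) j≤d)

  numberOfSlabs : ℕ
  numberOfSlabs = ∑[ v < n ] 𝟙[ offset v ≡0]

  open ZerosEnumeration (enumerateZeros offset)

  slab : Fin n → Fin numberOfSlabs
  slab v = index (top v) (offset-top v)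

  InSlab : Fin numberOfSlabs → Fin n → Set
  InSlab t v = slab v ≡ t

  same-slab⇒same-top : ∀ {u v} → slab u ≡ slab v → top u ≡ top v
  same-slab⇒same-top e = trans (sym (element-index _ _)) (trans (cong element e) (element-index _ _))

  same-top⇒same-slab : ∀ {u v} → top u ≡ top v → slab u ≡ slab v
  same-top⇒same-slab = index-cong _ _

  element-inSlab : ∀ t → InSlab t (element t)
  element-inSlab t = trans (index-cong _ (element-zero t) (cong (iterate parent (element t)) (element-zero t)))
                           (index-element t _)

  walk-up : ∀ {t} k v → k ≤ offset v → InSlab t v → WalkIn G (InSlab t) v (iterate parent v k)
  walk-up zero    v _   v∈t = [ v∈t ]
  walk-up (suc k) v k<o v∈t = v∈t ∷⟨ adj-parent v d≢0 ⟩ walk-up k (parent v) k≤o′ parent∈t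
    where
    d≢0 : depth v ≢ 0
    d≢0 d≡0 = contradiction (≤-trans k<o (subst (offset v ≤_) d≡0 (slabOffset≤depth s (depth v)))) λ ()
    k≤o′ : k ≤ offset (parent v)
    k≤o′ = subst (k ≤_) (sym (offset-iterate v (≤-trans (s≤s z≤n) k<o))) (∸-monoˡ-≤ 1 k<o)
    parent∈t : InSlab _ (parent v)
    parent∈t = trans (same-top⇒same-slab (top-iterate v (≤-trans (s≤s z≤n) k<o))) v∈t

  slab-connected : ∀ t u v → InSlab t u → InSlab t v → WalkIn G (InSlab t) u v
  slab-connected t u v u∈t v∈t = walk-up (offset u) u ≤-refl u∈t ++ʷ
    subst (λ w → WalkIn G (InSlab t) w v) (same-slab⇒same-top (trans v∈t (sym u∈t)))
          (reverseʷ (walk-up (offset v) v ≤-refl v∈t))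

  slab-acyclic : GirthAtLeast G 5 → ∀ t m → ¬ CycleIn G (InSlab t) m
  slab-acyclic girth t = tree-edges⇒acyclic parent depth tree-edge
    where
    tree-edge : ∀ u v → InSlab t u → InSlab t v → Adj u v → ChildOf parent depth u v ⊎ ChildOf parent depth v u
    tree-edge u v u∈t v∈t adj with normal u v adj
    ... | inj₁ u≤v = inj₁ (slab-edge⇒child girth adj (same-slab⇒same-top (trans u∈t (sym v∈t))) u≤v)
    ... | inj₂ v≤u = inj₂ (slab-edge⇒child girth (adj-sym adj) (same-slab⇒same-top (trans v∈t (sym u∈t))) v≤u)

  slabCover : GirthAtLeast G 5 → TreeCover G numberOfSlabs
  slabCover girth = record
    { part  = slab
    ; trees = λ t → (element t , element-inSlab t) , slab-connected t , slab-acyclic girth t }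

∑-numberOfSlabs≤ : ∀ {n} {G : SimpleGraph n} (T : NormalTree G) →
  ∑[ s < 4 ] Slabs.numberOfSlabs T (toℕ s) ≤ n + 3
∑-numberOfSlabs≤ {n} T = begin
  ∑[ s < 4 ] ∑[ v < n ] tops s v              ≡⟨ ∑-comm {4} {n} tops ⟩
  ∑[ v < n ] ∑[ s < 4 ] tops s v              ≡⟨ sum-cong-≗ {n} (∑-slabOffset≡0 ∘ depth) ⟩
  ∑[ v < n ] (1 + 3 * isRoot v)               ≡⟨ ∑-distrib-+ (const 1) (λ v → 3 * isRoot v) ⟩
  ∑[ v < n ] 1 + ∑[ v < n ] (3 * isRoot v)    ≡⟨ cong₂ _+_ (sum-const n 1) (sum-scaleˡ 3 isRoot) ⟩
  n * 1 + 3 * ∑[ v < n ] isRoot v             ≤⟨ +-mono-≤ (≤-reflexive (*-identityʳ n)) (*-monoʳ-≤ 3 unique-root) ⟩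
  n + 3                                       ∎
  where
  open ≤-Reasoning
  open NormalTree T
  tops : Fin 4 → Fin n → ℕ
  tops s v = 𝟙[ slabOffset (toℕ s) (depth v) ≡0]
  isRoot : Fin n → ℕ
  isRoot v = 𝟙[ depth v ≡0]
  unique-root : ∑[ v < n ] isRoot v ≤ 1
  unique-root = unique-zero⇒≤1 (enumerateZeros depth)
    λ u v u≡0 v≡0 → trans (depth≡0⇒root u u≡0) (sym (depth≡0⇒root v v≡0))

4a≤n+3⇒3a≤n : ∀ {a n} → 6 ≤ n → 4 * a ≤ n + 3 → 3 * a ≤ n
4a≤n+3⇒3a≤n {a} {n} 6≤n 4a≤n+3 with a ≤? 2
... | yes a≤2 = ≤-trans (*-monoʳ-≤ 3 a≤2) 6≤n
... | no  a≰2 = +-cancelˡ-≤ 3 (3 * a) n (begin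
  3 + 3 * a  ≤⟨ +-monoˡ-≤ (3 * a) (≰⇒> a≰2) ⟩
  4 * a      ≤⟨ 4a≤n+3 ⟩
  n + 3      ≡⟨ +-comm n 3 ⟩
  3 + n      ∎)
  where open ≤-Reasoning

mainTheorem10 : ∀ (n : ℕ) (G : SimpleGraph n) → 6 ≤ n → Connected G → GirthAtLeast G 5 →
    ∃ λ m → TreeCover G m × 3 * m ≤ n
mainTheorem10 zero    _ ()  _         _
mainTheorem10 (suc n) G 6≤n connected girth =
  let i , 4a≤∑ = ∃-below-average slabs
  in  slabs i , Slabs.slabCover T (toℕ i) girth ,
      4a≤n+3⇒3a≤n {slabs i} 6≤n (≤-trans 4a≤∑ (∑-numberOfSlabs≤ T))
  where
  T : NormalTree G
  T = normalTree G connected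
  slabs : Fin 4 → ℕ
  slabs s = Slabs.numberOfSlabs T (toℕ s)
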